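{- Let $w_1,w_2\in\{a,b\}^\star$ and let $u$ be the longest common prefix of $w_1$ and $w_2$. Then exactly one of the first three cases below occurs, and the stated conclusions hold: (1) if $w_1=u\,a\,u_1$ and $w_2=u\,b\,u_2$ for some words $u_1,u_2$, then $m(\overline{w_1}\,ab\,w_2)\ge m(\overline{w_1}\,ba\,w_2)$; (2) if $w_1=u\,b\,u_1$ and $w_2=u\,a\,u_2$, then $m(\overline{w_1}\,ab\,w_2)<m(\overline{w_1}\,ba\,w_2)$; (3) if $w_1=u$ or $w_2=u$, then $m(\overline{w_1}\,ab\,w_2)<m(\overline{w_1}\,ba\,w_2)$; (4) moreover, $m(\overline{w_1}\,ab\,w_2)=m(\overline{w_1}\,ba\,w_2)$ if and only if $w_1=ua$ and $w_2=ub$.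
   Context: For a word $w$, $\overline{w}$ denotes its reversal. Let $A=\begin{pmatrix}1&1\\1&2\end{pmatrix}$, $B=\begin{pmatrix}2&1\\1&1\end{pmatrix}$, and for $w=x_1\cdots x_k\in\{a,b\}^\star$ let $M^w=M^{x_1}\cdots M^{x_k}$ with $M^a=A$, $M^b=B$ ($M^w=I$ for the empty word). The $m$-value is $m(w)=\begin{pmatrix}1&0\end{pmatrix}M^w\begin{pmatrix}0\\1\end{pmatrix}$, the top-right entry of $M^w$. -}

module Defs where

open import Data.Nat using (ℕ; _+_; _*_)
open import Data.List using (List; []; _∷_; _++_; reverse)

data Letter : Set where
  a b : Letter

Word : Set
Word = List Letter

-- 2×2 matrices over ℕ, entries (row, column)
record Mat : Set where
  constructor mat
  field
    m11 m12 m21 m22 : ℕ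
open Mat public

_⊗_ : Mat → Mat → Mat
mat p q r s ⊗ mat p' q' r' s' =
  mat (p * p' + q * r') (p * q' + q * s') (r * p' + s * r') (r * q' + s * s')

I : Mat
I = mat 1 0 0 1

A B : Mat
A = mat 1 1 1 2
B = mat 2 1 1 1

M : Letter → Mat
M a = A
M b = B

Mw : Word → Mat
Mw []      = I
Mw (x ∷ w) = M x ⊗ Mw w

-- m(w) = (1 0) M^w (0 1)^T, the top-right entry
mval : Word → ℕ
mval w = m12 (Mw w)

rev : Word → Word
rev = reverse

lcp : Word → Word → Word
lcp (a ∷ v) (a ∷ w) = a ∷ lcp v w
lcp (b ∷ v) (b ∷ w) = b ∷ lcp v w
lcp _ _ = []

-- Since A and B are symmetric, m(w̄₁ x y w₂) is the top-right entry of (M^{w₁})ᵀ M^x M^y M^{w₂}.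
-- As AB − BA = 2 (0 −1; 1 0), this gives m(w̄₁ ab w₂) − m(w̄₁ ba w₂) = 2 (Q − P) with
-- P = M^{w₁}₁₁ M^{w₂}₂₂ and Q = M^{w₁}₂₁ M^{w₂}₁₂.  Now P − Q is the top-right entry of
-- (M^{w₁})ᵀ J M^{w₂} with J = (0 1; −1 0), and Xᵀ J X = J for X ∈ {A, B} because
-- det A = det B = 1; so P − Q is unchanged by stripping the longest common prefix of w₁
-- and w₂.  What remains is decided by the first letters after that prefix, using that the
-- diagonal entries of every M^w are positive and its off-diagonal ones vanish only for w = ε.
module Submission where

open import Defs
open import Data.Nat using (ℕ; suc; _≤_; _<_; _+_; _*_; >-nonZero)
open import Data.Nat.Properties
open import Data.Nat.Tactic.RingSolver using (solve-∀)
open import Algebra.Properties.CommutativeSemigroup +-commutativeSemigroup using (xy∙z≈xz∙y)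
open import Data.List using ([]; _∷_; _++_; _ʳ++_)
open import Data.List.Properties using (ʳ++-defn; ++-identityʳ; ++-identityʳ-unique; ++-cancelˡ; ∷-injectiveˡ)
open import Data.Product using (Σ; _×_; _,_; proj₁; proj₂; uncurry)
open import Data.Sum using (_⊎_; inj₁; inj₂)
open import Relation.Nullary using (¬_; contradiction)
open import Relation.Binary.PropositionalEquality
open import Function.Bundles using (_⇔_; mk⇔; Equivalence)

infix 4 _≃_

-- (p , q) ≃ (p' , q') says that p − q = p' − q' in ℤ.
record _≃_ (x y : ℕ × ℕ) : Set where
  constructor cross
  field
    cross-≡ : proj₁ x + proj₂ y ≡ proj₁ y + proj₂ x

≃-refl : ∀ {x} → x ≃ x
≃-refl = cross refl

≃-sym : ∀ {x y} → x ≃ y → y ≃ x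
≃-sym (cross e) = cross (sym e)

≃-trans : ∀ {p q p' q' p'' q''} → (p , q) ≃ (p' , q') → (p' , q') ≃ (p'' , q'') → (p , q) ≃ (p'' , q'')
≃-trans {p} {q} {p'} {q'} {p''} {q''} (cross e₁) (cross e₂) = cross (+-cancelʳ-≡ q' (p + q'') (p'' + q) (begin
  p + q'' + q'   ≡⟨ xy∙z≈xz∙y p q'' q' ⟩
  p + q' + q''   ≡⟨ cong (_+ q'') e₁ ⟩
  p' + q + q''   ≡⟨ xy∙z≈xz∙y p' q q'' ⟩
  p' + q'' + q   ≡⟨ cong (_+ q) e₂ ⟩
  p'' + q' + q   ≡⟨ xy∙z≈xz∙y p'' q' q ⟩
  p'' + q + q'   ∎))
  where open ≡-Reasoning

≃-≤ : ∀ {p q p' q'} → (p , q) ≃ (p' , q') → p ≤ q → p' ≤ q'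
≃-≤ {p} {q} {p'} {q'} (cross e) p≤q = +-cancelʳ-≤ q p' q' (subst₂ _≤_ e (+-comm q q') (+-monoˡ-≤ q' p≤q))

≃-< : ∀ {p q p' q'} → (p , q) ≃ (p' , q') → q < p → q' < p'
≃-< {p} {q} {p'} {q'} (cross e) q<p = +-cancelʳ-< q q' p' (subst₂ _<_ (+-comm q q') e (+-monoˡ-< q' q<p))

≃-≡ : ∀ {p q p' q'} → (p , q) ≃ (p' , q') → p ≡ q → p' ≡ q'
≃-≡ {p} {q} {p'} {q'} (cross e) refl = +-cancelʳ-≡ p p' q' (trans (sym e) (+-comm p q'))

transpose : Mat → Mat
transpose (mat p q r s) = mat p r q s

transpose-symmetric-shift : ∀ p q s (C Y : Mat) →
  m12 (transpose C ⊗ (mat p q q s ⊗ Y)) ≡ m12 (transpose (mat p q q s ⊗ C) ⊗ Y)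
transpose-symmetric-shift p q s (mat c₁₁ _ c₂₁ _) (mat _ y₁₂ _ y₂₂) = identity p q s c₁₁ c₂₁ y₁₂ y₂₂
  where
  identity : ∀ p q s c₁₁ c₂₁ y₁₂ y₂₂ →
    c₁₁ * (p * y₁₂ + q * y₂₂) + c₂₁ * (q * y₁₂ + s * y₂₂) ≡ (p * c₁₁ + q * c₂₁) * y₁₂ + (q * c₁₁ + s * c₂₁) * y₂₂
  identity = solve-∀

transpose-M-shift : ∀ x (C Y : Mat) → m12 (transpose C ⊗ (M x ⊗ Y)) ≡ m12 (transpose (M x ⊗ C) ⊗ Y)
transpose-M-shift a = transpose-symmetric-shift 1 1 2
transpose-M-shift b = transpose-symmetric-shift 2 1 1

mval-ʳ++ : ∀ w ys → mval (w ʳ++ ys) ≡ m12 (transpose (Mw w) ⊗ Mw ys)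
mval-ʳ++ []      ys = sym (trans (+-identityʳ _) (*-identityˡ _))
mval-ʳ++ (x ∷ w) ys = trans (mval-ʳ++ w (x ∷ ys)) (transpose-M-shift x (Mw w) (Mw ys))

mval-rev-++ : ∀ w ys → mval (rev w ++ ys) ≡ m12 (transpose (Mw w) ⊗ Mw ys)
mval-rev-++ w ys = trans (cong mval (sym (ʳ++-defn w))) (mval-ʳ++ w ys)

P Q : Word → Word → ℕ
P w₁ w₂ = m11 (Mw w₁) * m22 (Mw w₂)
Q w₁ w₂ = m21 (Mw w₁) * m12 (Mw w₂)

PQ : Word → Word → ℕ × ℕ
PQ w₁ w₂ = P w₁ w₂ , Q w₁ w₂

mval-swap : ∀ w₁ w₂ →
  (2 * P w₁ w₂ , 2 * Q w₁ w₂) ≃ (mval (rev w₁ ++ b ∷ a ∷ w₂) , mval (rev w₁ ++ a ∷ b ∷ w₂))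
mval-swap w₁ w₂ rewrite mval-rev-++ w₁ (a ∷ b ∷ w₂) | mval-rev-++ w₁ (b ∷ a ∷ w₂) =
  cross (identity (m11 (Mw w₁)) (m21 (Mw w₁)) (m12 (Mw w₂)) (m22 (Mw w₂)))
  where
  identity : ∀ c₁₁ c₂₁ d₁₂ d₂₂ →
      2 * (c₁₁ * d₂₂)
    + (c₁₁ * (1 * (2 * d₁₂ + 1 * d₂₂) + 1 * (1 * d₁₂ + 1 * d₂₂))
       + c₂₁ * (1 * (2 * d₁₂ + 1 * d₂₂) + 2 * (1 * d₁₂ + 1 * d₂₂)))
    ≡ (c₁₁ * (2 * (1 * d₁₂ + 1 * d₂₂) + 1 * (1 * d₁₂ + 2 * d₂₂))
       + c₂₁ * (1 * (1 * d₁₂ + 1 * d₂₂) + 1 * (1 * d₁₂ + 2 * d₂₂)))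
    + 2 * (c₂₁ * d₁₂)
  identity = solve-∀

PQ-∷ : ∀ x v w → PQ v w ≃ PQ (x ∷ v) (x ∷ w)
PQ-∷ a v w = cross (identity (m11 (Mw v)) (m21 (Mw v)) (m12 (Mw w)) (m22 (Mw w)))
  where
  identity : ∀ e f g h → e * h + (1 * e + 2 * f) * (1 * g + 1 * h) ≡ (1 * e + 1 * f) * (1 * g + 2 * h) + f * g
  identity = solve-∀
PQ-∷ b v w = cross (identity (m11 (Mw v)) (m21 (Mw v)) (m12 (Mw w)) (m22 (Mw w)))
  where
  identity : ∀ e f g h → e * h + (1 * e + 1 * f) * (2 * g + 1 * h) ≡ (2 * e + 1 * f) * (1 * g + 1 * h) + f * g
  identity = solve-∀

PQ-prefix : ∀ u v w → PQ v w ≃ PQ (u ++ v) (u ++ w)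
PQ-prefix []      v w = ≃-refl
PQ-prefix (x ∷ u) v w = ≃-trans (PQ-prefix u v w) (PQ-∷ x (u ++ v) (u ++ w))

≤-*-+ : ∀ k n m → n ≤ suc k * n + m
≤-*-+ k n m = ≤-trans (m≤m+n n (k * n)) (m≤m+n (suc k * n) m)

≤-+-* : ∀ k m n → n ≤ m + suc k * n
≤-+-* k m n = ≤-trans (m≤m+n n (k * n)) (m≤n+m (suc k * n) m)

column₁-≥-m11 : ∀ x C → m11 C ≤ m11 (M x ⊗ C) × m11 C ≤ m21 (M x ⊗ C)
column₁-≥-m11 a C = ≤-*-+ 0 (m11 C) (1 * m21 C) , ≤-*-+ 0 (m11 C) (2 * m21 C)
column₁-≥-m11 b C = ≤-*-+ 1 (m11 C) (1 * m21 C) , ≤-*-+ 0 (m11 C) (1 * m21 C)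

column₂-≥-m22 : ∀ x C → m22 C ≤ m12 (M x ⊗ C) × m22 C ≤ m22 (M x ⊗ C)
column₂-≥-m22 a C = ≤-+-* 0 (1 * m12 C) (m22 C) , ≤-+-* 1 (1 * m12 C) (m22 C)
column₂-≥-m22 b C = ≤-+-* 0 (2 * m12 C) (m22 C) , ≤-+-* 0 (1 * m12 C) (m22 C)

m11-pos : ∀ w → 0 < m11 (Mw w)
m11-pos []      = ≤-refl
m11-pos (x ∷ w) = ≤-trans (m11-pos w) (proj₁ (column₁-≥-m11 x (Mw w)))

m22-pos : ∀ w → 0 < m22 (Mw w)
m22-pos []      = ≤-refl
m22-pos (x ∷ w) = ≤-trans (m22-pos w) (proj₂ (column₂-≥-m22 x (Mw w)))

m21≡0⇒[] : ∀ w → m21 (Mw w) ≡ 0 → w ≡ []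
m21≡0⇒[] []      _  = refl
m21≡0⇒[] (x ∷ w) eq =
  contradiction (subst (0 <_) eq (≤-trans (m11-pos w) (proj₂ (column₁-≥-m11 x (Mw w))))) λ ()

m12≡0⇒[] : ∀ w → m12 (Mw w) ≡ 0 → w ≡ []
m12≡0⇒[] []      _  = refl
m12≡0⇒[] (x ∷ w) eq =
  contradiction (subst (0 <_) eq (≤-trans (m22-pos w) (proj₁ (column₂-≥-m22 x (Mw w))))) λ ()

module _ (u₁ u₂ : Word) where

  private
    e f g h : ℕ
    e = m11 (Mw u₁)
    f = m21 (Mw u₁)
    g = m12 (Mw u₂)
    h = m22 (Mw u₂)

  ab-Q≡P+ : Q (a ∷ u₁) (b ∷ u₂) ≡ P (a ∷ u₁) (b ∷ u₂) + (e * g + 3 * (f * g) + f * h)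
  ab-Q≡P+ = identity e f g h
    where
    identity : ∀ e f g h →
      (1 * e + 2 * f) * (2 * g + 1 * h) ≡ (1 * e + 1 * f) * (1 * g + 1 * h) + (e * g + 3 * (f * g) + f * h)
    identity = solve-∀

  ba-P≡Q+ : P (b ∷ u₁) (a ∷ u₂) ≡ Q (b ∷ u₁) (a ∷ u₂) + (e * h + (e * g + 2 * (e * h) + f * h))
  ba-P≡Q+ = identity e f g h
    where
    identity : ∀ e f g h →
      (2 * e + 1 * f) * (1 * g + 2 * h) ≡ (1 * e + 1 * f) * (1 * g + 1 * h) + (e * h + (e * g + 2 * (e * h) + f * h))
    identity = solve-∀

  P≤Q-ab : P (a ∷ u₁) (b ∷ u₂) ≤ Q (a ∷ u₁) (b ∷ u₂)
  P≤Q-ab = subst (P (a ∷ u₁) (b ∷ u₂) ≤_) (sym ab-Q≡P+) (m≤m+n _ _)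

  P≡Q-ab⇒[] : P (a ∷ u₁) (b ∷ u₂) ≡ Q (a ∷ u₁) (b ∷ u₂) → u₁ ≡ [] × u₂ ≡ []
  P≡Q-ab⇒[] eq = m21≡0⇒[] u₁ f≡0 , m12≡0⇒[] u₂ g≡0
    where
    gap≡0 : e * g + 3 * (f * g) + f * h ≡ 0
    gap≡0 = sym (+-cancelˡ-≡ (P (a ∷ u₁) (b ∷ u₂)) 0 _ (trans (+-identityʳ _) (trans eq ab-Q≡P+)))
    g≡0 : g ≡ 0
    g≡0 = m*n≡0⇒m≡0 g e {{>-nonZero (m11-pos u₁)}}
            (trans (*-comm g e) (m+n≡0⇒m≡0 (e * g) (m+n≡0⇒m≡0 _ gap≡0)))
    f≡0 : f ≡ 0
    f≡0 = m*n≡0⇒m≡0 f h {{>-nonZero (m22-pos u₂)}} (m+n≡0⇒n≡0 _ gap≡0)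

  Q<P-ba : Q (b ∷ u₁) (a ∷ u₂) < P (b ∷ u₁) (a ∷ u₂)
  Q<P-ba = subst (Q (b ∷ u₁) (a ∷ u₂) <_) (sym ba-P≡Q+)
             (m<m+n _ (≤-trans (*-mono-≤ (m11-pos u₁) (m22-pos u₂)) (m≤m+n (e * h) _)))

Q<P-[]ˡ : ∀ w → Q [] w < P [] w
Q<P-[]ˡ w = ≤-trans (m22-pos w) (m≤m+n _ 0)

Q<P-[]ʳ : ∀ w → Q w [] < P w []
Q<P-[]ʳ w = subst₂ _<_ (sym (*-zeroʳ (m21 (Mw w)))) (sym (*-identityʳ (m11 (Mw w)))) (m11-pos w)

data Divergent : Word → Word → Set where
  ab : ∀ u₁ u₂ → Divergent (a ∷ u₁) (b ∷ u₂)
  ba : ∀ u₁ u₂ → Divergent (b ∷ u₁) (a ∷ u₂)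
  []ˡ : ∀ r → Divergent [] r
  []ʳ : ∀ r → Divergent r []

record Split (u w₁ w₂ : Word) : Set where
  constructor split
  field
    {rest₁ rest₂} : Word
    w₁≡u++rest₁   : w₁ ≡ u ++ rest₁
    w₂≡u++rest₂   : w₂ ≡ u ++ rest₂
    divergent     : Divergent rest₁ rest₂

split-∷ : ∀ x {u w₁ w₂} → Split u w₁ w₂ → Split (x ∷ u) (x ∷ w₁) (x ∷ w₂)
split-∷ x (split e₁ e₂ d) = split (cong (x ∷_) e₁) (cong (x ∷_) e₂) d

lcp-split : ∀ w₁ w₂ → Split (lcp w₁ w₂) w₁ w₂
lcp-split []      w       = split refl refl ([]ˡ w)
lcp-split (a ∷ v) []      = split refl refl ([]ʳ _)
lcp-split (b ∷ v) []      = split refl refl ([]ʳ _)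
lcp-split (a ∷ v) (a ∷ w) = split-∷ a (lcp-split v w)
lcp-split (b ∷ v) (b ∷ w) = split-∷ b (lcp-split v w)
lcp-split (a ∷ v) (b ∷ w) = split refl refl (ab v w)
lcp-split (b ∷ v) (a ∷ w) = split refl refl (ba v w)

DivergesAt : Letter → Letter → Word → Word → Set
DivergesAt x y w₁ w₂ = Σ Word λ u₁ → Σ Word λ u₂ → (w₁ ≡ lcp w₁ w₂ ++ x ∷ u₁) × (w₂ ≡ lcp w₁ w₂ ++ y ∷ u₂)

OneIsPrefix : Word → Word → Set
OneIsPrefix w₁ w₂ = (w₁ ≡ lcp w₁ w₂) ⊎ (w₂ ≡ lcp w₁ w₂)

divergesAt-or-oneIsPrefix : ∀ w₁ w₂ → DivergesAt a b w₁ w₂ ⊎ DivergesAt b a w₁ w₂ ⊎ OneIsPrefix w₁ w₂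
divergesAt-or-oneIsPrefix w₁ w₂ with lcp-split w₁ w₂
... | split e₁ e₂ (ab u₁ u₂) = inj₁ (u₁ , u₂ , e₁ , e₂)
... | split e₁ e₂ (ba u₁ u₂) = inj₂ (inj₁ (u₁ , u₂ , e₁ , e₂))
... | split e₁ _  ([]ˡ _)     = inj₂ (inj₂ (inj₁ (trans e₁ (++-identityʳ _))))
... | split _  e₂ ([]ʳ _)     = inj₂ (inj₂ (inj₂ (trans e₂ (++-identityʳ _))))

divergesAt-unique : ∀ {x y x' y' w₁ w₂} → DivergesAt x y w₁ w₂ → DivergesAt x' y' w₁ w₂ → x ≡ x'
divergesAt-unique {w₁ = w₁} {w₂} (_ , _ , e , _) (_ , _ , e' , _) =
  ∷-injectiveˡ (++-cancelˡ (lcp w₁ w₂) _ _ (trans (sym e) e'))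

divergesAt⇒¬oneIsPrefix : ∀ {x y w₁ w₂} → DivergesAt x y w₁ w₂ → ¬ OneIsPrefix w₁ w₂
divergesAt⇒¬oneIsPrefix {w₁ = w₁} {w₂} (_ , _ , e₁ , _) (inj₁ w₁≡u) =
  contradiction (++-identityʳ-unique (lcp w₁ w₂) (trans (sym w₁≡u) e₁)) λ ()
divergesAt⇒¬oneIsPrefix {w₁ = w₁} {w₂} (_ , _ , _ , e₂) (inj₂ w₂≡u) =
  contradiction (++-identityʳ-unique (lcp w₁ w₂) (trans (sym w₂≡u) e₂)) λ ()

divergesAt-ab⇒P≤Q : ∀ w₁ w₂ → DivergesAt a b w₁ w₂ → P w₁ w₂ ≤ Q w₁ w₂
divergesAt-ab⇒P≤Q w₁ w₂ (u₁ , u₂ , e₁ , e₂) =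
  subst₂ (λ v w → P v w ≤ Q v w) (sym e₁) (sym e₂) (≃-≤ (PQ-prefix (lcp w₁ w₂) (a ∷ u₁) (b ∷ u₂)) (P≤Q-ab u₁ u₂))

divergesAt-ba⇒Q<P : ∀ w₁ w₂ → DivergesAt b a w₁ w₂ → Q w₁ w₂ < P w₁ w₂
divergesAt-ba⇒Q<P w₁ w₂ (u₁ , u₂ , e₁ , e₂) =
  subst₂ (λ v w → Q v w < P v w) (sym e₁) (sym e₂) (≃-< (PQ-prefix (lcp w₁ w₂) (b ∷ u₁) (a ∷ u₂)) (Q<P-ba u₁ u₂))

oneIsPrefix⇒Q<P : ∀ w₁ w₂ → OneIsPrefix w₁ w₂ → Q w₁ w₂ < P w₁ w₂
oneIsPrefix⇒Q<P w₁ w₂ prefix with lcp-split w₁ w₂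
oneIsPrefix⇒Q<P w₁ w₂ (inj₁ w₁≡u) | split {rest₂ = r} e₁ e₂ _
  with ++-identityʳ-unique (lcp w₁ w₂) (trans (sym w₁≡u) e₁)
... | refl = subst₂ (λ v w → Q v w < P v w) (sym e₁) (sym e₂) (≃-< (PQ-prefix (lcp w₁ w₂) [] r) (Q<P-[]ˡ r))
oneIsPrefix⇒Q<P w₁ w₂ (inj₂ w₂≡u) | split {rest₁ = r} e₁ e₂ _
  with ++-identityʳ-unique (lcp w₁ w₂) (trans (sym w₂≡u) e₂)
... | refl = subst₂ (λ v w → Q v w < P v w) (sym e₁) (sym e₂) (≃-< (PQ-prefix (lcp w₁ w₂) r []) (Q<P-[]ʳ r))

P≡Q⇔ends-with-a-b-after-lcp : ∀ w₁ w₂ → P w₁ w₂ ≡ Q w₁ w₂ ⇔ ((w₁ ≡ lcp w₁ w₂ ++ a ∷ []) × (w₂ ≡ lcp w₁ w₂ ++ b ∷ []))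
P≡Q⇔ends-with-a-b-after-lcp w₁ w₂ = mk⇔ to from
  where
  u : Word
  u = lcp w₁ w₂
  to : P w₁ w₂ ≡ Q w₁ w₂ → (w₁ ≡ u ++ a ∷ []) × (w₂ ≡ u ++ b ∷ [])
  to eq with divergesAt-or-oneIsPrefix w₁ w₂
  ... | inj₂ (inj₁ c) = contradiction (divergesAt-ba⇒Q<P w₁ w₂ c) (<-irrefl (sym eq))
  ... | inj₂ (inj₂ c) = contradiction (oneIsPrefix⇒Q<P w₁ w₂ c) (<-irrefl (sym eq))
  ... | inj₁ (u₁ , u₂ , e₁ , e₂)
    with P≡Q-ab⇒[] u₁ u₂ (≃-≡ (≃-sym (PQ-prefix u (a ∷ u₁) (b ∷ u₂))) (subst₂ (λ v w → P v w ≡ Q v w) e₁ e₂ eq))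
  ...   | refl , refl = e₁ , e₂
  from : (w₁ ≡ u ++ a ∷ []) × (w₂ ≡ u ++ b ∷ []) → P w₁ w₂ ≡ Q w₁ w₂
  from (e₁ , e₂) = subst₂ (λ v w → P v w ≡ Q v w) (sym e₁) (sym e₂) (≃-≡ (PQ-prefix u (a ∷ []) (b ∷ [])) refl)

lemma2p8 : (w₁ w₂ : Word) →
    let u = lcp w₁ w₂
        L = mval (rev w₁ ++ a ∷ b ∷ w₂)
        R = mval (rev w₁ ++ b ∷ a ∷ w₂)
        C₁ = Σ Word (λ u₁ → Σ Word (λ u₂ → (w₁ ≡ u ++ a ∷ u₁) × (w₂ ≡ u ++ b ∷ u₂)))
        C₂ = Σ Word (λ u₁ → Σ Word (λ u₂ → (w₁ ≡ u ++ b ∷ u₁) × (w₂ ≡ u ++ a ∷ u₂)))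
        C₃ = (w₁ ≡ u) ⊎ (w₂ ≡ u)
    in ((C₁ ⊎ C₂ ⊎ C₃) × ¬ (C₁ × C₂) × ¬ (C₁ × C₃) × ¬ (C₂ × C₃))
       × (C₁ → R ≤ L)
       × (C₂ → L < R)
       × (C₃ → L < R)
       × ((L ≡ R) ⇔ ((w₁ ≡ u ++ a ∷ []) × (w₂ ≡ u ++ b ∷ [])))
lemma2p8 w₁ w₂ =
    ( divergesAt-or-oneIsPrefix w₁ w₂
    , (λ (c₁ , c₂) → contradiction (divergesAt-unique c₁ c₂) λ ())
    , uncurry divergesAt⇒¬oneIsPrefix
    , uncurry divergesAt⇒¬oneIsPrefix )
  , (λ c → ≃-≤ swap (*-monoʳ-≤ 2 (divergesAt-ab⇒P≤Q w₁ w₂ c)))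
  , (λ c → ≃-< swap (*-monoʳ-< 2 (divergesAt-ba⇒Q<P w₁ w₂ c)))
  , (λ c → ≃-< swap (*-monoʳ-< 2 (oneIsPrefix⇒Q<P w₁ w₂ c)))
  , mk⇔ (λ L≡R → to (*-cancelˡ-≡ _ _ 2 (≃-≡ (≃-sym swap) (sym L≡R))))
        (λ leaves → sym (≃-≡ swap (cong (2 *_) (from leaves))))
  where
  swap : (2 * P w₁ w₂ , 2 * Q w₁ w₂) ≃ (mval (rev w₁ ++ b ∷ a ∷ w₂) , mval (rev w₁ ++ a ∷ b ∷ w₂))
  swap = mval-swap w₁ w₂
  open Equivalence (P≡Q⇔ends-with-a-b-after-lcp w₁ w₂) using (to; from)
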